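{- For $n\ge 3$, the Connected-compelling chromatic number of the path $P_n$ on $n$ vertices is $n-1$.
   Context: A proper coloring partitions the vertex set into nonempty independent color classes; a rainbow committee (RC) is a set consisting of exactly one vertex of each color. A proper coloring is Connected-compelling if every RC induces a connected subgraph; the Connected-compelling chromatic number is the minimum number of colors in such a coloring. -}

module Defs where

open import Data.Nat using (ℕ; suc; _≤_)
open import Data.Fin using (Fin; toℕ)
open import Data.Product using (Σ; ∃; _×_; _,_; proj₁)
open import Data.Sum using (_⊎_)
open import Relation.Binary.PropositionalEquality using (_≡_; _≢_)
open import Function.Definitions using (Surjective)

Graph : ℕ → Set₁
Graph n = Fin n → Fin n → Set

Path : (n : ℕ) → Graph n
Path n i j = (toℕ j ≡ suc (toℕ i)) ⊎ (toℕ i ≡ suc (toℕ j))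

-- A proper coloring with exactly k colors: every color class nonempty
-- (the coloring map is surjective) and adjacent vertices get distinct colors.
record ProperColoring {n : ℕ} (G : Graph n) (k : ℕ) : Set where
  field
    col    : Fin n → Fin k
    onto   : Surjective _≡_ _≡_ col
    proper : ∀ u v → G u v → col u ≢ col v

RainbowCommittee : {n : ℕ} {G : Graph n} {k : ℕ} → ProperColoring G k → Set
RainbowCommittee {n} {G} {k} c = Σ (Fin k → Fin n) λ r → ∀ a → ProperColoring.col c (r a) ≡ a

InRC : {n : ℕ} {G : Graph n} {k : ℕ} {c : ProperColoring G k} →
       RainbowCommittee c → Fin n → Set
InRC {k = k} R v = Σ (Fin k) λ a → proj₁ R a ≡ v

data WalkIn {n : ℕ} (G : Graph n) (S : Fin n → Set) : Fin n → Fin n → Set where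
  here : ∀ {u} → S u → WalkIn G S u u
  step : ∀ {u v w} → S u → G u v → WalkIn G S v w → WalkIn G S u w

InducedConnected : {n : ℕ} (G : Graph n) (S : Fin n → Set) → Set
InducedConnected G S = ∀ u v → S u → S v → WalkIn G S u v

ConnectedCompelling : {n : ℕ} {G : Graph n} {k : ℕ} → ProperColoring G k → Set
ConnectedCompelling {G = G} c = (R : RainbowCommittee c) → InducedConnected G (InRC {c = c} R)

IsCCChromaticNumber : {n : ℕ} → Graph n → ℕ → Set
IsCCChromaticNumber G k =
  (Σ (ProperColoring G k) ConnectedCompelling) ×
  (∀ m → (c : ProperColoring G m) → ConnectedCompelling c → k ≤ m)

{-# OPTIONS --safe #-}
module Submission where

-- A walk in a path visits every vertex between its ends. So if a connected-compelling
-- colouring gives vertex v a colour different from that of vertex 0, a rainbow committee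
-- through 0 and v contains the v + 1 vertices 0, …, v, and there are more than v colours;
-- one of the two (adjacent) last vertices is such a v, giving at least n − 1 colours.
-- Conversely, colouring vertex i by i mod (n − 1) gives the two endpoints the same colour
-- and every interior vertex a class of its own, so every rainbow committee contains all
-- interior vertices and is therefore connected.

open import Defs
open import Data.Nat using (ℕ; zero; suc; _+_; _∸_; _≤_; _<_; z≤n; s≤s; z<s; s≤s⁻¹)
open import Data.Nat.DivMod using (_%_; _mod_; m<n⇒m%n≡m; n%n≡0)
open import Data.Nat.Properties
  using (≤-refl; ≤-antisym; ≤-reflexive; ≤-trans; ≤-<-trans; <⇒≤; n≤1+n; m≤m+n; +-suc; +-identityʳ;
         ≤-total; m≤n⇒m<n∨m≡n; m<1+n⇒m<n∨m≡n; m≤n⇒∃[o]m+o≡n; 1+n≢n; m<n⇒n≢0)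
open import Data.Fin using (Fin; toℕ; fromℕ; fromℕ<; inject₁; inject≤) renaming (zero to fzero; suc to fsuc)
open import Data.Fin.Properties
  using (toℕ-injective; toℕ<n; toℕ-fromℕ; toℕ-fromℕ<; toℕ-inject₁; toℕ-inject≤; inject≤-injective; injective⇒≤)
  renaming (_≟_ to _≟ᶠ_)
open import Data.Product using (Σ; ∃; _×_; _,_; proj₁; proj₂)
open import Data.Sum using (_⊎_; inj₁; inj₂; [_,_]; swap)
open import Function using (_∘_)
open import Function.Definitions using (Injective; Surjective)
open import Relation.Binary.Definitions using (Symmetric)
open import Relation.Nullary using (Dec; yes; no)
open import Relation.Nullary.Negation using (contradiction)
open import Relation.Binary.PropositionalEquality using (_≡_; _≢_; refl; sym; trans; cong; subst; module ≡-Reasoning)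

module _ {n : ℕ} {G : Graph n} {S : Fin n → Set} where

  walk-start : ∀ {u v} → WalkIn G S u v → S u
  walk-start (here su)     = su
  walk-start (step su _ _) = su

  reverse-onto : Symmetric G → ∀ {u v w} → WalkIn G S u v → WalkIn G S u w → WalkIn G S v w
  reverse-onto G-sym (here _)      acc = acc
  reverse-onto G-sym (step _ uv W) acc = reverse-onto G-sym W (step (walk-start W) (G-sym uv) acc)

  reverse : Symmetric G → ∀ {u v} → WalkIn G S u v → WalkIn G S v u
  reverse G-sym W = reverse-onto G-sym W (here (walk-start W))

Path-sym : ∀ {n} → Symmetric (Path n)
Path-sym = swap

Interior : ∀ {n} → Fin n → Set
Interior {n} j = 0 < toℕ j × suc (toℕ j) < n

module _ {n : ℕ} {S : Fin n → Set} where

  walk-covers-interval : ∀ {u w} → WalkIn (Path n) S u w →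
                         ∀ j → toℕ u ≤ toℕ j → toℕ j ≤ toℕ w → S j
  walk-covers-interval (here su) j u≤j j≤u = subst S (toℕ-injective (≤-antisym u≤j j≤u)) su
  walk-covers-interval (step _ (inj₂ u≡1+v) W) j u≤j j≤w =
    walk-covers-interval W j (≤-trans (subst (_ ≤_) (sym u≡1+v) (n≤1+n _)) u≤j) j≤w
  walk-covers-interval {u} (step su (inj₁ v≡1+u) W) j u≤j j≤w with m≤n⇒m<n∨m≡n u≤j
  ... | inj₁ u<j = walk-covers-interval W j (subst (_≤ toℕ j) (sym v≡1+u) u<j) j≤w
  ... | inj₂ u≡j = subst S (toℕ-injective u≡j) su

  ascending-walk : ∀ d {u v} → toℕ u + d ≡ toℕ v →
                   (∀ j → toℕ u ≤ toℕ j → toℕ j ≤ toℕ v → S j) → WalkIn (Path n) S u v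
  ascending-walk zero {u} u+0≡v S⊇ =
    subst (WalkIn (Path n) S u) u≡v (here (S⊇ u ≤-refl (≤-reflexive (cong toℕ u≡v))))
    where
    u≡v : u ≡ _
    u≡v = toℕ-injective (trans (sym (+-identityʳ _)) u+0≡v)
  ascending-walk (suc d) {u} {v} u+1+d≡v S⊇ =
    step (S⊇ u ≤-refl u≤v) (inj₁ next≡1+u)
         (ascending-walk d next+d≡v (λ j next≤j → S⊇ j (≤-trans (n≤1+n _) (subst (_≤ toℕ j) next≡1+u next≤j))))
    where
    1+u+d≡v : suc (toℕ u + d) ≡ toℕ v
    1+u+d≡v = trans (sym (+-suc (toℕ u) d)) u+1+d≡v
    u≤v : toℕ u ≤ toℕ v
    u≤v = subst (toℕ u ≤_) u+1+d≡v (m≤m+n (toℕ u) (suc d))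
    1+u<n : suc (toℕ u) < n
    1+u<n = ≤-<-trans (subst (suc (toℕ u) ≤_) 1+u+d≡v (s≤s (m≤m+n (toℕ u) d))) (toℕ<n v)
    next : Fin n
    next = fromℕ< 1+u<n
    next≡1+u : toℕ next ≡ suc (toℕ u)
    next≡1+u = toℕ-fromℕ< 1+u<n
    next+d≡v : toℕ next + d ≡ toℕ v
    next+d≡v = trans (cong (_+ d) next≡1+u) 1+u+d≡v

  interval⊆⇒walk : ∀ {u v} → toℕ u ≤ toℕ v →
                   (∀ j → toℕ u ≤ toℕ j → toℕ j ≤ toℕ v → S j) → WalkIn (Path n) S u v
  interval⊆⇒walk u≤v = ascending-walk _ (proj₂ (m≤n⇒∃[o]m+o≡n u≤v))

  interior⊆⇒interval⊆ : (∀ j → Interior j → S j) → ∀ {u v} → S u → S v →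
                        ∀ j → toℕ u ≤ toℕ j → toℕ j ≤ toℕ v → S j
  interior⊆⇒interval⊆ S⊇interior {u} {v} su sv j u≤j j≤v with m≤n⇒m<n∨m≡n u≤j | m≤n⇒m<n∨m≡n j≤v
  ... | inj₂ u≡j | _        = subst S (toℕ-injective u≡j) su
  ... | inj₁ _   | inj₂ j≡v = subst S (toℕ-injective (sym j≡v)) sv
  ... | inj₁ u<j | inj₁ j<v = S⊇interior j (≤-<-trans z≤n u<j , ≤-<-trans j<v (toℕ<n v))

  interior⊆⇒connected : (∀ j → Interior j → S j) → InducedConnected (Path n) S
  interior⊆⇒connected S⊇interior u v su sv with ≤-total (toℕ u) (toℕ v)
  ... | inj₁ u≤v = interval⊆⇒walk u≤v (interior⊆⇒interval⊆ S⊇interior su sv)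
  ... | inj₂ v≤u = reverse Path-sym (interval⊆⇒walk v≤u (interior⊆⇒interval⊆ S⊇interior sv su))

module _ {n k : ℕ} {G : Graph n} (c : ProperColoring G k) where
  open ProperColoring c

  singleton-class⇒∈RC : ∀ {j} → (∀ w → col w ≡ col j → w ≡ j) →
                        (R : RainbowCommittee c) → InRC {c = c} R j
  singleton-class⇒∈RC {j} only (r , r-ok) = col j , only (r (col j)) (r-ok (col j))

  module _ {u v : Fin n} (col-u≢col-v : col u ≢ col v) where

    representative : ∀ a → ∃ λ w → col w ≡ a
    representative a with a ≟ᶠ col u | a ≟ᶠ col v
    ... | yes a≡col-u | _           = u , sym a≡col-u
    ... | no _        | yes a≡col-v = v , sym a≡col-v
    ... | no _        | no _        = proj₁ (onto a) , proj₂ (onto a) refl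

    representative-u : proj₁ (representative (col u)) ≡ u
    representative-u with col u ≟ᶠ col u
    ... | yes _         = refl
    ... | no col-u≢self = contradiction refl col-u≢self

    representative-v : proj₁ (representative (col v)) ≡ v
    representative-v with col v ≟ᶠ col u | col v ≟ᶠ col v
    ... | yes col-v≡col-u | _             = contradiction (sym col-v≡col-u) col-u≢col-v
    ... | no _            | yes _         = refl
    ... | no _            | no col-v≢self = contradiction refl col-v≢self

    rainbow-through : Σ (RainbowCommittee c) λ R → InRC {c = c} R u × InRC {c = c} R v
    rainbow-through = ((λ a → proj₁ (representative a)) , (λ a → proj₂ (representative a)))
                    , (col u , representative-u) , (col v , representative-v)

  initial-segment⊆RC⇒< : (R : RainbowCommittee c) (v : Fin n) →
                         (∀ j → toℕ j ≤ toℕ v → InRC {c = c} R j) → toℕ v < k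
  initial-segment⊆RC⇒< (r , _) v segment⊆R = injective⇒≤ colour-of-inj
    where
    vertex : Fin (suc (toℕ v)) → Fin n
    vertex i = inject≤ i (toℕ<n v)
    vertex∈R : ∀ i → ∃ λ a → r a ≡ vertex i
    vertex∈R i = segment⊆R (vertex i) (subst (_≤ toℕ v) (sym (toℕ-inject≤ i (toℕ<n v))) (s≤s⁻¹ (toℕ<n i)))
    colour-of : Fin (suc (toℕ v)) → Fin k
    colour-of i = proj₁ (vertex∈R i)
    colour-of-inj : Injective _≡_ _≡_ colour-of
    colour-of-inj {i} {i′} eq = inject≤-injective _ _ i i′
      (trans (sym (proj₂ (vertex∈R i))) (trans (cong r eq) (proj₂ (vertex∈R i′))))

differs-from-start⇒toℕ< : ∀ {n m} (c : ProperColoring (Path (suc n)) m) → ConnectedCompelling c →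
                          ∀ {v} → ProperColoring.col c fzero ≢ ProperColoring.col c v → toℕ v < m
differs-from-start⇒toℕ< c compelling {v} col₀≢col-v with rainbow-through c col₀≢col-v
... | R , 0∈R , v∈R = initial-segment⊆RC⇒< c R v
                        (λ j j≤v → walk-covers-interval (compelling R fzero v 0∈R v∈R) j z≤n j≤v)

connected-compelling⇒≥ : ∀ n m (c : ProperColoring (Path n) m) → ConnectedCompelling c → n ∸ 1 ≤ m
connected-compelling⇒≥ 0 _ _ _ = z≤n
connected-compelling⇒≥ 1 _ _ _ = z≤n
connected-compelling⇒≥ (suc (suc n)) m c compelling = by-colour-of-penultimate (col penultimate ≟ᶠ col fzero)
  where
  open ProperColoring c
  penultimate last : Fin (suc (suc n))
  penultimate = inject₁ (fromℕ n)
  last        = fromℕ (suc n)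
  col-pen≢col-last : col penultimate ≢ col last
  col-pen≢col-last = proper penultimate last (inj₁ (cong suc (sym (toℕ-inject₁ (fromℕ n)))))
  by-colour-of-penultimate : Dec (col penultimate ≡ col fzero) → suc n ≤ m
  by-colour-of-penultimate (yes pen≡0) =
    <⇒≤ (subst (_< m) (toℕ-fromℕ (suc n))
          (differs-from-start⇒toℕ< c compelling (λ 0≡last → col-pen≢col-last (trans pen≡0 0≡last))))
  by-colour-of-penultimate (no pen≢0) =
    subst (_< m) (trans (toℕ-inject₁ (fromℕ n)) (toℕ-fromℕ n))
      (differs-from-start⇒toℕ< c compelling (λ 0≡pen → pen≢0 (sym 0≡pen)))

module WrapColouring (k : ℕ) where

  N : ℕ
  N = suc (suc k)

  wrap : Fin (suc N) → Fin N
  wrap i = toℕ i mod N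

  toℕ-wrap-< : ∀ i → toℕ i < N → toℕ (wrap i) ≡ toℕ i
  toℕ-wrap-< i i<N = trans (toℕ-fromℕ< _) (m<n⇒m%n≡m i<N)

  toℕ-wrap-last : ∀ i → toℕ i ≡ N → toℕ (wrap i) ≡ 0
  toℕ-wrap-last i i≡N = trans (toℕ-fromℕ< _) (trans (cong (_% N) i≡N) (n%n≡0 N))

  interior-class-singleton : ∀ j → Interior j → ∀ w → wrap w ≡ wrap j → w ≡ j
  interior-class-singleton j (0<j , 1+j<1+N) w wrap-w≡wrap-j with m<1+n⇒m<n∨m≡n (toℕ<n w)
  ... | inj₁ w<N = toℕ-injective (begin
          toℕ w          ≡⟨ toℕ-wrap-< w w<N ⟨
          toℕ (wrap w)   ≡⟨ cong toℕ wrap-w≡wrap-j ⟩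
          toℕ (wrap j)   ≡⟨ toℕ-wrap-< j (s≤s⁻¹ 1+j<1+N) ⟩
          toℕ j          ∎)
    where open ≡-Reasoning
  ... | inj₂ w≡N = contradiction
          (trans (sym (toℕ-wrap-< j (s≤s⁻¹ 1+j<1+N))) (trans (cong toℕ (sym wrap-w≡wrap-j)) (toℕ-wrap-last w w≡N)))
          (m<n⇒n≢0 0<j)

  wrap-onto : Surjective _≡_ _≡_ wrap
  wrap-onto a = inject₁ a , λ { refl → toℕ-injective (trans
    (toℕ-wrap-< (inject₁ a) (subst (_< N) (sym (toℕ-inject₁ a)) (toℕ<n a))) (toℕ-inject₁ a)) }

  adjacent⇒interior : ∀ (u : Fin (suc N)) {v : Fin (suc N)} → toℕ v ≡ suc (toℕ u) →
                      Interior u ⊎ Interior v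
  adjacent⇒interior fzero    {v} v≡1   =
    inj₂ (subst (0 <_) (sym v≡1) z<s , subst (_< suc N) (cong suc (sym v≡1)) (s≤s (s≤s (s≤s z≤n))))
  adjacent⇒interior (fsuc u) {v} v≡2+u =
    inj₁ (z<s , subst (_< suc N) v≡2+u (toℕ<n v))

  wrap-adjacent : ∀ (u : Fin (suc N)) {v} → toℕ v ≡ suc (toℕ u) → wrap u ≢ wrap v
  wrap-adjacent u {v} v≡1+u wrap-u≡wrap-v = 1+n≢n (trans (sym v≡1+u) (cong toℕ v≡u))
    where
    v≡u : v ≡ u
    v≡u = [ (λ interior-u → interior-class-singleton u interior-u v (sym wrap-u≡wrap-v))
          , (λ interior-v → sym (interior-class-singleton v interior-v u wrap-u≡wrap-v))
          ] (adjacent⇒interior u v≡1+u)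

  wrap-proper : ∀ u v → Path (suc N) u v → wrap u ≢ wrap v
  wrap-proper u v (inj₁ v≡1+u) = wrap-adjacent u v≡1+u
  wrap-proper u v (inj₂ u≡1+v) = wrap-adjacent v u≡1+v ∘ sym

  wrap-colouring : ProperColoring (Path (suc N)) N
  wrap-colouring = record { col = wrap ; onto = wrap-onto ; proper = wrap-proper }

  wrap-compelling : ConnectedCompelling wrap-colouring
  wrap-compelling R = interior⊆⇒connected
    (λ j interior-j → singleton-class⇒∈RC wrap-colouring (interior-class-singleton j interior-j) R)

open WrapColouring using (wrap-colouring; wrap-compelling)

mainTheorem14 : (n : ℕ) → 3 ≤ n → IsCCChromaticNumber (Path n) (n ∸ 1)
mainTheorem14 (suc (suc (suc k))) _ = (wrap-colouring k , wrap-compelling k) , connected-compelling⇒≥ _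
mainTheorem14 1 (s≤s ())
mainTheorem14 2 (s≤s (s≤s ()))
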